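{- Let $(P,\leq,{}',0,1)$ be a poset with complementation. (a) If $(P,\leq,{}',0,1)$ is pseudo-Boolean and $M,R:P^2\to2^P$ are defined by $M(x,y)=L(x,y)$ and $R(x,y)=L(U(y,x'))$, then $(P,\leq,{}',M,R,0,1)$ is an operator residuated poset. (b) If $(P,\leq,{}',0,1)$ is pseudo-orthomodular and satisfies $1'=0$, and $M,R:P^2\to2^P$ are defined by $M(x,y)=L(U(x,y'),y)$ and $R(x,y)=L(U(L(y,x),x'))$, then $(P,\leq,{}',M,R,0,1)$ is an operator left residuated poset.
   Context: For a poset $(P,\leq)$ and $A\subseteq P$ let $L(A)=\{x\in P\mid x\leq a\text{ for all }a\in A\}$ and $U(A)=\{x\in P\mid a\leq x\text{ for all }a\in A\}$; write $L(x)=L(\{x\})$, and when several elements or subsets are listed as arguments the union of them is meant, e.g. $L(x,y)=L(\{x,y\})$, $L(U(x,y'),y)=L(U(\{x,y'\})\cup\{y\})$. A poset with complementation is $(P,\leq,{}',0,1)$ where $(P,\leq,0,1)$ is a bounded poset and ${}'$ is a unary operation with $L(x,x')=\{0\}$, $U(x,x')=\{1\}$, $x\leq y\Rightarrow y'\leq x'$, and $x''=x$ for all $x,y$. It is pseudo-Boolean if $L(U(x,y),y')=L(x,y')$ for all $x,y\in P$, and pseudo-orthomodular if $L(U(L(x,y),y'),y)=L(x,y)$ for all $x,y\in P$. An operator left residuated poset is an ordered seventuple $(P,\leq,{}',M,R,0,1)$ with $(P,\leq,0,1)$ bounded, ${}'$ unary, and $M,R:P^2\to2^P$ satisfying for all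 $x,y,z$: (i) $M(x,1)=M(1,x)=L(x)$; (ii) $M(x,y)\subseteq L(z)$ iff $L(x)\subseteq R(y,z)$; (iii) $R(x,0)=L(x')$. It is an operator residuated poset if moreover $M(x,y)=M(y,x)$ for all $x,y$. -}

module Defs where

open import Level using (Level; _⊔_; suc)
open import Data.Product using (_×_; _,_)
open import Data.Sum using (_⊎_)
open import Relation.Binary.PropositionalEquality using (_≡_)

Subset : ∀ {c} (ℓ : Level) → Set c → Set (c ⊔ suc ℓ)
Subset ℓ A = A → Set ℓ

module _ {c ℓ₁ ℓ₂ : Level} {A : Set c} where
  _⊆_ : Subset ℓ₁ A → Subset ℓ₂ A → Set (c ⊔ ℓ₁ ⊔ ℓ₂)
  S ⊆ T = ∀ x → S x → T x

module _ {c ℓ : Level} {A : Set c} where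
  _≐_ : Subset ℓ A → Subset ℓ A → Set (c ⊔ ℓ)
  S ≐ T = (S ⊆ T) × (T ⊆ S)


record BoundedPosetWithOp (c ℓ : Level) : Set (suc (c ⊔ ℓ)) where
  infix 4 _≤_
  field
    Carrier : Set c
    _≤_     : Carrier → Carrier → Set ℓ
    ≤-refl  : ∀ x → x ≤ x
    ≤-trans : ∀ {x y z} → x ≤ y → y ≤ z → x ≤ z
    ≤-antisym : ∀ {x y} → x ≤ y → y ≤ x → x ≡ y
    _′      : Carrier → Carrier
    𝟘 𝟙     : Carrier
    𝟘-min   : ∀ x → 𝟘 ≤ x
    𝟙-max   : ∀ x → x ≤ 𝟙

  Sub : Set (suc (c ⊔ ℓ))
  Sub = Subset (c ⊔ ℓ) Carrier

  L : Sub → Sub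
  L S x = ∀ a → S a → x ≤ a

  U : Sub → Sub
  U S x = ∀ a → S a → a ≤ x

  ⟦_⟧ : Carrier → Sub
  ⟦ a ⟧ x = Level.Lift ℓ (x ≡ a)

  ⟦_﹐_⟧ : Carrier → Carrier → Sub
  ⟦ a ﹐ b ⟧ x = Level.Lift ℓ ((x ≡ a) ⊎ (x ≡ b))

  _∪⟦_⟧ : Sub → Carrier → Sub
  (S ∪⟦ a ⟧) x = S x ⊎ Level.Lift ℓ (x ≡ a)

  L₁ : Carrier → Sub
  L₁ a = L ⟦ a ⟧

  L₂ : Carrier → Carrier → Sub
  L₂ a b = L ⟦ a ﹐ b ⟧

  U₂ : Carrier → Carrier → Sub
  U₂ a b = U ⟦ a ﹐ b ⟧

  record IsComplementation : Set (c ⊔ ℓ) where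
    field
      L-compl : ∀ x → L₂ x (x ′) ≐ ⟦ 𝟘 ⟧
      U-compl : ∀ x → U₂ x (x ′) ≐ ⟦ 𝟙 ⟧
      antitone : ∀ {x y} → x ≤ y → y ′ ≤ x ′
      involutive : ∀ x → (x ′) ′ ≡ x

  -- pseudo-Boolean: L(U(x,y), y') = L(x, y')
  IsPseudoBoolean : Set (c ⊔ ℓ)
  IsPseudoBoolean = ∀ x y → L (U₂ x y ∪⟦ y ′ ⟧) ≐ L₂ x (y ′)

  -- pseudo-orthomodular: L(U(L(x,y), y'), y) = L(x, y)
  IsPseudoOrthomodular : Set (c ⊔ ℓ)
  IsPseudoOrthomodular = ∀ x y → L (U (L₂ x y ∪⟦ y ′ ⟧) ∪⟦ y ⟧) ≐ L₂ x y

  record IsOperatorLeftResiduated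
      (M R : Carrier → Carrier → Sub) : Set (suc (c ⊔ ℓ)) where
    field
      M-1ʳ : ∀ x → M x 𝟙 ≐ L₁ x
      M-1ˡ : ∀ x → M 𝟙 x ≐ L₁ x
      adjoint : ∀ x y z → ((M x y ⊆ L₁ z) → (L₁ x ⊆ R y z))
                        × ((L₁ x ⊆ R y z) → (M x y ⊆ L₁ z))
      R-0 : ∀ x → R x 𝟘 ≐ L₁ (x ′)

  record IsOperatorResiduated
      (M R : Carrier → Carrier → Sub) : Set (suc (c ⊔ ℓ)) where
    field
      isLeft : IsOperatorLeftResiduated M R
      M-comm : ∀ x y → M x y ≐ M y x

  Mᵃ Rᵃ : Carrier → Carrier → Sub
  Mᵃ x y = L₂ x y
  Rᵃ x y = L (U₂ y (x ′))

  -- (b): M(x,y) = L(U(x,y'),y), R(x,y) = L(U(L(y,x),x'))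
  Mᵇ Rᵇ : Carrier → Carrier → Sub
  Mᵇ x y = L (U₂ x (y ′) ∪⟦ y ⟧)
  Rᵇ x y = L (U (L₂ y x ∪⟦ x ′ ⟧))

-- In a complemented poset, L(x) ⊆ L(S) just says that x is a lower bound of S, so both
-- adjunctions become order statements. In (a), pseudo-Booleanity gives the Boolean rule
-- "L(x,u') ⊆ L(u) implies x ≤ u": every common upper bound t of u and x' has t' below x and u',
-- hence t' ≤ u ∧ u' = 0 and t = 1. In (b), pseudo-orthomodularity applied to (x', y) shows that
-- x lies below every upper bound of M(x,y) ∪ {y'}, which is the forward direction; the
-- backward direction is pseudo-orthomodularity applied to (z, y).
module Submission where

open import Defs
open import Level using (Level; lift; lower)
open import Data.Product using (_×_; _,_; proj₁)
open import Data.Sum using (inj₁; inj₂)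
open import Relation.Binary.PropositionalEquality using (_≡_; refl; subst; sym; trans; cong)

module Cones {c ℓ : Level} (P : BoundedPosetWithOp c ℓ) where
  open BoundedPosetWithOp P

  ∈⟦⟧ : ∀ {a} → ⟦ a ⟧ a
  ∈⟦⟧ = lift refl

  ∈⟦﹐⟧ˡ : ∀ {a b} → ⟦ a ﹐ b ⟧ a
  ∈⟦﹐⟧ˡ = lift (inj₁ refl)

  ∈⟦﹐⟧ʳ : ∀ {a b} → ⟦ a ﹐ b ⟧ b
  ∈⟦﹐⟧ʳ = lift (inj₂ refl)

  pattern ∈∪⟦⟧ = inj₂ (lift refl)

  L₁⁺ : ∀ {w a} → w ≤ a → L₁ a w
  L₁⁺ w≤a _ (lift refl) = w≤a

  L₁⁻ : ∀ {w a} → L₁ a w → w ≤ a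
  L₁⁻ w∈L₁a = w∈L₁a _ ∈⟦⟧

  L₂⁺ : ∀ {w a b} → w ≤ a → w ≤ b → L₂ a b w
  L₂⁺ w≤a w≤b _ (lift (inj₁ refl)) = w≤a
  L₂⁺ w≤a w≤b _ (lift (inj₂ refl)) = w≤b

  U₂⁺ : ∀ {v a b} → a ≤ v → b ≤ v → U₂ a b v
  U₂⁺ a≤v b≤v _ (lift (inj₁ refl)) = a≤v
  U₂⁺ a≤v b≤v _ (lift (inj₂ refl)) = b≤v

  L-∪⟦⟧⁺ : ∀ {S a w} → L S w → w ≤ a → L (S ∪⟦ a ⟧) w
  L-∪⟦⟧⁺ w∈LS w≤a s (inj₁ s∈S) = w∈LS s s∈S
  L-∪⟦⟧⁺ w∈LS w≤a _ ∈∪⟦⟧ = w≤a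

  U-∪⟦⟧⁺ : ∀ {S a v} → U S v → a ≤ v → U (S ∪⟦ a ⟧) v
  U-∪⟦⟧⁺ v∈US a≤v s (inj₁ s∈S) = v∈US s s∈S
  U-∪⟦⟧⁺ v∈US a≤v _ ∈∪⟦⟧ = a≤v

  L₁⊆L⇒∈L : ∀ {S x} → L₁ x ⊆ L S → L S x
  L₁⊆L⇒∈L L₁x⊆LS = L₁x⊆LS _ (L₁⁺ (≤-refl _))

  ∈L⇒L₁⊆L : ∀ {S x} → L S x → L₁ x ⊆ L S
  ∈L⇒L₁⊆L x∈LS w w∈L₁x s s∈S = ≤-trans (L₁⁻ w∈L₁x) (x∈LS s s∈S)

  L₂-comm : ∀ a b → L₂ a b ⊆ L₂ b a
  L₂-comm a b w w∈L₂ab = L₂⁺ (w∈L₂ab _ ∈⟦﹐⟧ʳ) (w∈L₂ab _ ∈⟦﹐⟧ˡ)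

  L₂-𝟙ʳ : ∀ a → L₂ a 𝟙 ≐ L₁ a
  L₂-𝟙ʳ a = (λ w w∈L₂ → L₁⁺ (w∈L₂ _ ∈⟦﹐⟧ˡ)) , (λ w w∈L₁ → L₂⁺ (L₁⁻ w∈L₁) (𝟙-max w))

  L₂-𝟙ˡ : ∀ a → L₂ 𝟙 a ≐ L₁ a
  L₂-𝟙ˡ a = (λ w w∈L₂ → proj₁ (L₂-𝟙ʳ a) w (L₂-comm 𝟙 a w w∈L₂))
          , (λ w w∈L₁ → L₂-comm a 𝟙 w (L₂⁺ (L₁⁻ w∈L₁) (𝟙-max w)))

  L-U-sup : ∀ {S a} → U S a → (∀ t → U S t → a ≤ t) → L (U S) ≐ L₁ a
  L-U-sup a∈US a-least = (λ w w∈LUS → L₁⁺ (w∈LUS _ a∈US))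
                       , (λ w w∈L₁a t t∈US → ≤-trans (L₁⁻ w∈L₁a) (a-least t t∈US))

module Complementation {c ℓ : Level} (P : BoundedPosetWithOp c ℓ)
  (C : BoundedPosetWithOp.IsComplementation P) where
  open BoundedPosetWithOp P
  open IsComplementation C
  open Cones P

  ′≤⇒′≤ : ∀ {a b} → a ′ ≤ b → b ′ ≤ a
  ′≤⇒′≤ {a} {b} a′≤b = subst (b ′ ≤_) (involutive a) (antitone a′≤b)

  ≤′⇒≤′ : ∀ {a b} → a ≤ b ′ → b ≤ a ′
  ≤′⇒≤′ {a} {b} a≤b′ = subst (_≤ a ′) (involutive b) (antitone a≤b′)

  ′-reflects-≤ : ∀ {a b} → a ′ ≤ b ′ → b ≤ a
  ′-reflects-≤ {a} a′≤b′ = subst (_ ≤_) (involutive a) (≤′⇒≤′ a′≤b′)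

  ≤′′ : ∀ a → a ≤ a ′ ′
  ≤′′ a = subst (a ≤_) (sym (involutive a)) (≤-refl a)

  ≤∧≤′⇒≡𝟘 : ∀ {w a} → w ≤ a → w ≤ a ′ → w ≡ 𝟘
  ≤∧≤′⇒≡𝟘 {w} {a} w≤a w≤a′ = lower (proj₁ (L-compl a) w (L₂⁺ w≤a w≤a′))

  𝟘′≡𝟙 : 𝟘 ′ ≡ 𝟙
  𝟘′≡𝟙 = lower (proj₁ (U-compl 𝟘) (𝟘 ′) (U₂⁺ (𝟘-min _) (≤-refl _)))

  ′≡𝟘⇒≡𝟙 : ∀ {a} → a ′ ≡ 𝟘 → a ≡ 𝟙
  ′≡𝟘⇒≡𝟙 {a} a′≡𝟘 = trans (sym (involutive a)) (trans (cong _′ a′≡𝟘) 𝟘′≡𝟙)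

module PseudoBoolean {c ℓ : Level} (P : BoundedPosetWithOp c ℓ)
  (C : BoundedPosetWithOp.IsComplementation P)
  (PB : BoundedPosetWithOp.IsPseudoBoolean P) where
  open BoundedPosetWithOp P
  open IsComplementation C
  open Cones P
  open Complementation P C

  L₂-′⊆L₁⇒≤ : ∀ {x u} → L₂ x (u ′) ⊆ L₁ u → x ≤ u
  L₂-′⊆L₁⇒≤ {x} {u} L₂xu′⊆L₁u = proj₁ (PB u (x ′)) x x∈L u ∈⟦﹐⟧ˡ
    where
    x≤upper : ∀ t → U₂ u (x ′) t → x ≤ t
    x≤upper t t∈U = subst (x ≤_) (sym (′≡𝟘⇒≡𝟙 t′≡𝟘)) (𝟙-max x)
      where
      t′≤u′ : t ′ ≤ u ′
      t′≤u′ = antitone (t∈U _ ∈⟦﹐⟧ˡ)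
      t′≡𝟘 : t ′ ≡ 𝟘
      t′≡𝟘 = ≤∧≤′⇒≡𝟘 (L₁⁻ (L₂xu′⊆L₁u _ (L₂⁺ (′≤⇒′≤ (t∈U _ ∈⟦﹐⟧ʳ)) t′≤u′))) t′≤u′

    x∈L : L (U₂ u (x ′) ∪⟦ x ′ ′ ⟧) x
    x∈L = L-∪⟦⟧⁺ x≤upper (≤′′ x)

  Mᵃ⊆L₁⇒∈L : ∀ x y z → Mᵃ x y ⊆ L₁ z → L (U₂ z (y ′)) x
  Mᵃ⊆L₁⇒∈L x y z Mxy⊆L₁z u u∈U = L₂-′⊆L₁⇒≤ λ w w∈L₂ →
    L₁⁺ (≤-trans (L₁⁻ (Mxy⊆L₁z w (L₂⁺ (w∈L₂ _ ∈⟦﹐⟧ˡ) (≤-trans (w∈L₂ _ ∈⟦﹐⟧ʳ) u′≤y))))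
                 (u∈U _ ∈⟦﹐⟧ˡ))
    where
    u′≤y : u ′ ≤ y
    u′≤y = ′≤⇒′≤ (u∈U _ ∈⟦﹐⟧ʳ)

  ∈L⇒Mᵃ⊆L₁ : ∀ x y z → L (U₂ z (y ′)) x → Mᵃ x y ⊆ L₁ z
  ∈L⇒Mᵃ⊆L₁ x y z x∈L w w∈L₂ = L₁⁺ (proj₁ (PB z (y ′)) w w∈L _ ∈⟦﹐⟧ˡ)
    where
    w∈L : L (U₂ z (y ′) ∪⟦ y ′ ′ ⟧) w
    w∈L = L-∪⟦⟧⁺ (∈L⇒L₁⊆L x∈L w (L₁⁺ (w∈L₂ _ ∈⟦﹐⟧ˡ))) (≤-trans (w∈L₂ _ ∈⟦﹐⟧ʳ) (≤′′ y))

  operatorResiduated : IsOperatorResiduated Mᵃ Rᵃ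
  operatorResiduated = record
    { isLeft = record
      { M-1ʳ = L₂-𝟙ʳ
      ; M-1ˡ = L₂-𝟙ˡ
      ; adjoint = λ x y z → (λ M⊆L₁ → ∈L⇒L₁⊆L (Mᵃ⊆L₁⇒∈L x y z M⊆L₁))
                          , (λ L₁⊆R → ∈L⇒Mᵃ⊆L₁ x y z (L₁⊆L⇒∈L L₁⊆R))
      ; R-0 = λ x → L-U-sup (U₂⁺ (𝟘-min _) (≤-refl _)) (λ t t∈U → t∈U _ ∈⟦﹐⟧ʳ)
      }
    ; M-comm = λ x y → L₂-comm x y , L₂-comm y x
    }

module PseudoOrthomodular {c ℓ : Level} (P : BoundedPosetWithOp c ℓ)
  (C : BoundedPosetWithOp.IsComplementation P)
  (PO : BoundedPosetWithOp.IsPseudoOrthomodular P) where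
  open BoundedPosetWithOp P
  open IsComplementation C
  open Cones P
  open Complementation P C

  ′-upper⇒∈Mᵇ : ∀ {x y t} → U (L₂ (x ′) y ∪⟦ y ′ ⟧) t → Mᵇ x y (t ′)
  ′-upper⇒∈Mᵇ t∈U = L-∪⟦⟧⁺
    (λ r r∈U → ′≤⇒′≤ (t∈U _ (inj₁ (L₂⁺ (antitone (r∈U _ ∈⟦﹐⟧ˡ)) (′≤⇒′≤ (r∈U _ ∈⟦﹐⟧ʳ))))))
    (′≤⇒′≤ (t∈U _ ∈∪⟦⟧))

  upper-Mᵇ∪⟦′⟧⇒≤ : ∀ {x y v} → U (Mᵇ x y ∪⟦ y ′ ⟧) v → x ≤ v
  upper-Mᵇ∪⟦′⟧⇒≤ {x} {y} {v} v∈U = ′-reflects-≤ (proj₁ (PO (x ′) y) (v ′) v′∈L _ ∈⟦﹐⟧ˡ)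
    where
    v′∈L : L (U (L₂ (x ′) y ∪⟦ y ′ ⟧) ∪⟦ y ⟧) (v ′)
    v′∈L = L-∪⟦⟧⁺ (λ t t∈U → ′≤⇒′≤ (v∈U _ (inj₁ (′-upper⇒∈Mᵇ t∈U)))) (′≤⇒′≤ (v∈U _ ∈∪⟦⟧))

  Mᵇ⊆L₁⇒∈L : ∀ x y z → Mᵇ x y ⊆ L₁ z → L (U (L₂ z y ∪⟦ y ′ ⟧)) x
  Mᵇ⊆L₁⇒∈L x y z Mxy⊆L₁z v v∈U = upper-Mᵇ∪⟦′⟧⇒≤ (U-∪⟦⟧⁺
    (λ s s∈M → v∈U s (inj₁ (L₂⁺ (L₁⁻ (Mxy⊆L₁z s s∈M)) (s∈M _ ∈∪⟦⟧))))
    (v∈U _ ∈∪⟦⟧))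

  ∈L⇒Mᵇ⊆L₁ : ∀ x y z → L (U (L₂ z y ∪⟦ y ′ ⟧)) x → Mᵇ x y ⊆ L₁ z
  ∈L⇒Mᵇ⊆L₁ x y z x∈L w w∈M = L₁⁺ (proj₁ (PO z y) w w∈L _ ∈⟦﹐⟧ˡ)
    where
    w∈L : L (U (L₂ z y ∪⟦ y ′ ⟧) ∪⟦ y ⟧) w
    w∈L = L-∪⟦⟧⁺ (λ v v∈U → w∈M v (inj₁ (U₂⁺ (x∈L v v∈U) (v∈U _ ∈∪⟦⟧)))) (w∈M _ ∈∪⟦⟧)

  operatorLeftResiduated : 𝟙 ′ ≡ 𝟘 → IsOperatorLeftResiduated Mᵇ Rᵇ
  operatorLeftResiduated 𝟙′≡𝟘 = record
    { M-1ʳ = λ x → (λ w w∈M → L₁⁺ (w∈M x (inj₁ (U₂⁺ (≤-refl x) (𝟙′≤ x)))))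
                 , (λ w w∈L₁ → L-∪⟦⟧⁺ (λ t t∈U → ≤-trans (L₁⁻ w∈L₁) (t∈U _ ∈⟦﹐⟧ˡ)) (𝟙-max w))
    ; M-1ˡ = λ x → (λ w w∈M → L₁⁺ (w∈M x ∈∪⟦⟧))
                 , (λ w w∈L₁ → L-∪⟦⟧⁺ (λ t t∈U → ≤-trans (𝟙-max w) (t∈U _ ∈⟦﹐⟧ˡ)) (L₁⁻ w∈L₁))
    ; adjoint = λ x y z → (λ M⊆L₁ → ∈L⇒L₁⊆L (Mᵇ⊆L₁⇒∈L x y z M⊆L₁))
                        , (λ L₁⊆R → ∈L⇒Mᵇ⊆L₁ x y z (L₁⊆L⇒∈L L₁⊆R))
    ; R-0 = λ x → L-U-sup (U-∪⟦⟧⁺ (λ s s∈L₂ → ≤-trans (s∈L₂ _ ∈⟦﹐⟧ˡ) (𝟘-min _)) (≤-refl _))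
                          (λ t t∈U → t∈U _ ∈∪⟦⟧)
    }
    where
    𝟙′≤ : ∀ a → 𝟙 ′ ≤ a
    𝟙′≤ a = subst (_≤ a) (sym 𝟙′≡𝟘) (𝟘-min a)

corollary1 : ∀ {c ℓ : Level} (P : BoundedPosetWithOp c ℓ) →
    BoundedPosetWithOp.IsComplementation P →
    ((BoundedPosetWithOp.IsPseudoBoolean P →
        BoundedPosetWithOp.IsOperatorResiduated P (BoundedPosetWithOp.Mᵃ P) (BoundedPosetWithOp.Rᵃ P))
    × (BoundedPosetWithOp.IsPseudoOrthomodular P →
        BoundedPosetWithOp._′ P (BoundedPosetWithOp.𝟙 P) ≡ BoundedPosetWithOp.𝟘 P →
        BoundedPosetWithOp.IsOperatorLeftResiduated P (BoundedPosetWithOp.Mᵇ P) (BoundedPosetWithOp.Rᵇ P)))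
corollary1 P C = (λ PB → PseudoBoolean.operatorResiduated P C PB)
               , (λ PO → PseudoOrthomodular.operatorLeftResiduated P C PO)
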